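{- Let $p\geqslant 5$ be a prime. Consider a circle of length $p$, i.e. $p$ cells arranged cyclically, where a domino occupies two cyclically adjacent cells and a placement of dominos is a set of dominos no two of which share a cell. Then the number of placements consisting of an even, nonzero number of dominos equals the number of placements consisting of an odd number of dominos.
   Context: Equivalently, a placement of $m$ dominos on the circle of length $p$ is a set of $m$ pairwise disjoint edges of the cycle graph on $p$ vertices. -}

module Defs where

open import Data.Bool using (Bool; true; false; _∧_; _∨_; not; if_then_else_)
open import Data.Nat using (ℕ; zero; suc; _+_; NonZero)
open import Data.Nat.DivMod using (_mod_)
open import Data.Fin using (Fin; toℕ)
open import Data.Fin.Properties using (_≟_)
open import Data.Fin.Subset using (Subset; ∣_∣)
open import Data.Vec using (Vec; []; _∷_; lookup)
open import Data.List using (List; []; _∷_; map; _++_; length; filterᵇ)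
open import Data.Bool.ListAction using (all)
open import Data.List using (allFin)
open import Relation.Nullary.Decidable using (⌊_⌋)

next : (p : ℕ) .{{_ : NonZero p}} → Fin p → Fin p
next p c = (toℕ c + 1) mod p

-- The dominos (edges of the cycle graph C_p) are indexed by Fin p:
-- domino i occupies the two cells i and next i.
-- Two dominos share a cell.
shareCell : (p : ℕ) .{{_ : NonZero p}} → Fin p → Fin p → Bool
shareCell p i j =
  ⌊ i ≟ j ⌋ ∨ ⌊ i ≟ next p j ⌋ ∨ ⌊ next p i ≟ j ⌋ ∨ ⌊ next p i ≟ next p j ⌋

isPlacement : (p : ℕ) .{{_ : NonZero p}} → Subset p → Bool
isPlacement p S =
  all (λ i → all (λ j →
        not (lookup S i ∧ lookup S j ∧ not ⌊ i ≟ j ⌋ ∧ shareCell p i j))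
      (allFin p))
    (allFin p)

allSubsets : (n : ℕ) → List (Subset n)
allSubsets zero = [] ∷ []
allSubsets (suc n) = map (false ∷_) (allSubsets n) ++ map (true ∷_) (allSubsets n)

placements : (p : ℕ) .{{_ : NonZero p}} → List (Subset p)
placements p = filterᵇ (isPlacement p) (allSubsets p)

even? : ℕ → Bool
even? zero = true
even? (suc n) = not (even? n)

isZero : ℕ → Bool
isZero zero = true
isZero (suc _) = false

#evenNonzero : (p : ℕ) .{{_ : NonZero p}} → ℕ
#evenNonzero p =
  length (filterᵇ (λ S → even? ∣ S ∣ ∧ not (isZero ∣ S ∣)) (placements p))

#odd : (p : ℕ) .{{_ : NonZero p}} → ℕ
#odd p = length (filterᵇ (λ S → not (even? ∣ S ∣)) (placements p))

{-# OPTIONS --safe #-}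
-- Placements on the circle of length p are the sets of cells i with no two cyclically
-- consecutive i, next i, i.e. the independent sets of the cycle C_p, so
-- #evenNonzero p + 1 - #odd p is the alternating sum of (-1)^|S| over them.  Splitting
-- off the first cell turns it into alternating sums over paths with prescribed end bits;
-- these satisfy a(n+1) = a(n) - a(n-1) and are therefore 6-periodic.  For the cycle the
-- sum is 1 whenever p ≡ ±1 (mod 6), which every prime p ≥ 5 satisfies.
module Submission where

open import Defs
open import Data.Nat using (ℕ; _≤_; NonZero)
open import Data.Nat.Primality using (Prime)
open import Relation.Binary.PropositionalEquality using (_≡_)

open import Data.Bool using (Bool; true; false; _∧_; not; if_then_else_; T)
open import Data.Bool.Properties using (T-∧; T-∨; T?)
open import Data.Bool.ListAction using (all)
open import Data.Empty using (⊥; ⊥-elim)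
open import Data.Fin using (Fin; zero; suc; toℕ; fromℕ; inject₁)
open import Data.Fin.Properties
  using (_≟_; toℕ-injective; toℕ-fromℕ<; toℕ-inject₁; toℕ-fromℕ; toℕ<n; suc-injective; ∀-cons)
open import Data.Fin.Relation.Unary.Top using (view; ‵fromℕ; ‵inject₁)
open import Data.Fin.Subset using (Subset; ∣_∣)
open import Data.Integer using (ℤ; +_; -_; _+_; _-_)
import Data.Integer.Properties as ℤ
open import Data.Integer.Tactic.RingSolver using (solve-∀)
open import Data.List using (List; []; _∷_; map; _++_; length; filterᵇ; allFin)
open import Data.List.Properties using (filter-++; filter-≐; length-++; length-map)
open import Data.List.Relation.Unary.All.Properties using (all⁺; all⁻; tabulate⁺; tabulate⁻)
open import Data.Nat as ℕ using (zero; suc; s≤s; z≤n; _<_; NonTrivial)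
import Data.Nat.Properties as ℕ
open import Data.Nat.DivMod using (_%_; _/_; m<n⇒m%n≡m; n%n≡0; m%n<n; m≡m%n+[m/n]*n)
open import Data.Nat.Divisibility using (_∣_; divides; ∣-refl; ∣-trans; ∣m∣n⇒∣m+n; n∣m*n)
open import Data.Nat.Primality using (composite)
open import Data.Product using (_,_; ∃-syntax)
open import Data.Sum using (_⊎_; inj₁; inj₂; [_,_])
open import Data.Vec using (Vec; []; _∷_; _∷ʳ_; lookup; replicate)
open import Data.Vec.Properties using (lookup-replicate)
open import Function using (_∘_; _⇔_; mk⇔; Equivalence)
open import Function.Properties.Equivalence using () renaming (trans to ⇔-trans; sym to ⇔-sym)
open import Relation.Nullary.Decidable using (⌊_⌋; toWitness; toWitnessFalse; fromWitness; fromWitnessFalse)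
open import Relation.Binary.PropositionalEquality
  using (_≢_; refl; sym; trans; cong; cong₂; subst; module ≡-Reasoning)

open Equivalence using (to; from)

private
  variable
    n : ℕ

T-not-∧ : ∀ {a b} → T (not (a ∧ b)) ⇔ (T a → T b → ⊥)
T-not-∧ {true}  {true}  = mk⇔ (λ ()) (λ h → h _ _)
T-not-∧ {true}  {false} = mk⇔ (λ _ _ ()) (λ _ → _)
T-not-∧ {false}         = mk⇔ (λ _ ()) (λ _ → _)

T-⇔⇒≡ : ∀ {a b} → T a ⇔ T b → a ≡ b
T-⇔⇒≡ {true}  {true}  _ = refl
T-⇔⇒≡ {true}  {false} h = ⊥-elim (to h _)
T-⇔⇒≡ {false} {true}  h = ⊥-elim (from h _)
T-⇔⇒≡ {false} {false} _ = refl

T-all-allFin : (f : Fin n → Bool) → T (all f (allFin n)) ⇔ (∀ i → T (f i))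
T-all-allFin f = mk⇔ (tabulate⁻ ∘ all⁺ f _) (all⁻ f ∘ tabulate⁺)

filterᵇ-map : ∀ {A B : Set} (P : B → Bool) (f : A → B) (L : List A) →
  filterᵇ P (map f L) ≡ map f (filterᵇ (P ∘ f) L)
filterᵇ-map P f []      = refl
filterᵇ-map P f (x ∷ L) with P (f x)
... | true  = cong (f x ∷_) (filterᵇ-map P f L)
... | false = filterᵇ-map P f L

filterᵇ-false : ∀ {A : Set} (L : List A) → filterᵇ (λ _ → false) L ≡ []
filterᵇ-false []      = refl
filterᵇ-false (x ∷ L) = filterᵇ-false L

count : ∀ {A : Set} → (A → Bool) → List A → ℕ
count P L = length (filterᵇ P L)

count-++ : ∀ {A : Set} (P : A → Bool) (L M : List A) →
  count P (L ++ M) ≡ count P L ℕ.+ count P M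
count-++ P L M = trans (cong length (filter-++ (T? ∘ P) L M)) (length-++ (filterᵇ P L))

count-map : ∀ {A B : Set} (P : B → Bool) (f : A → B) (L : List A) →
  count P (map f L) ≡ count (P ∘ f) L
count-map P f L = trans (cong length (filterᵇ-map P f L)) (length-map f (filterᵇ (P ∘ f) L))

lookup-∷ʳ-inject₁ : ∀ {A : Set} (x : A) (V : Vec A n) (i : Fin n) →
  lookup (V ∷ʳ x) (inject₁ i) ≡ lookup V i
lookup-∷ʳ-inject₁ x (y ∷ V) zero    = refl
lookup-∷ʳ-inject₁ x (y ∷ V) (suc i) = lookup-∷ʳ-inject₁ x V i

lookup-∷ʳ-fromℕ : ∀ {A : Set} (x : A) (V : Vec A n) → lookup (V ∷ʳ x) (fromℕ n) ≡ x
lookup-∷ʳ-fromℕ x []      = refl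
lookup-∷ʳ-fromℕ x (y ∷ V) = lookup-∷ʳ-fromℕ x V

next-inject₁ : (j : Fin n) → next (suc n) (inject₁ j) ≡ suc j
next-inject₁ {n} j = toℕ-injective (begin
  toℕ (next (suc n) (inject₁ j))  ≡⟨ toℕ-fromℕ< _ ⟩
  (toℕ (inject₁ j) ℕ.+ 1) % suc n ≡⟨ cong (λ k → (k ℕ.+ 1) % suc n) (toℕ-inject₁ j) ⟩
  (toℕ j ℕ.+ 1) % suc n           ≡⟨ cong (_% suc n) (ℕ.+-comm (toℕ j) 1) ⟩
  suc (toℕ j) % suc n             ≡⟨ m<n⇒m%n≡m (s≤s (toℕ<n j)) ⟩
  suc (toℕ j)                     ∎)
  where open ≡-Reasoning

next-fromℕ : ∀ n → next (suc n) (fromℕ n) ≡ zero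
next-fromℕ n = toℕ-injective (begin
  toℕ (next (suc n) (fromℕ n))  ≡⟨ toℕ-fromℕ< _ ⟩
  (toℕ (fromℕ n) ℕ.+ 1) % suc n ≡⟨ cong (λ k → (k ℕ.+ 1) % suc n) (toℕ-fromℕ n) ⟩
  (n ℕ.+ 1) % suc n             ≡⟨ cong (_% suc n) (ℕ.+-comm n 1) ⟩
  suc n % suc n                 ≡⟨ n%n≡0 (suc n) ⟩
  0                             ∎)
  where open ≡-Reasoning

next-injective : {i j : Fin (suc n)} → next (suc n) i ≡ next (suc n) j → i ≡ j
next-injective {n} {i} {j} eq with view i | view j
... | ‵fromℕ     | ‵fromℕ     = refl
... | ‵fromℕ     | ‵inject₁ l with () ← trans (sym (next-fromℕ n)) (trans eq (next-inject₁ l))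
... | ‵inject₁ k | ‵fromℕ     with () ← trans (sym (next-inject₁ k)) (trans eq (next-fromℕ n))
... | ‵inject₁ k | ‵inject₁ l =
  cong inject₁ (suc-injective (trans (sym (next-inject₁ k)) (trans eq (next-inject₁ l))))

next-≢ : 1 ≤ n → (i : Fin (suc n)) → next (suc n) i ≢ i
next-≢ {suc n} _ i eq with view i
... | ‵fromℕ     with () ← trans (sym (next-fromℕ (suc n))) eq
... | ‵inject₁ k = ℕ.1+n≢n (begin
  suc (toℕ k)                      ≡⟨ cong toℕ (sym (next-inject₁ k)) ⟩
  toℕ (next (2 ℕ.+ n) (inject₁ k)) ≡⟨ cong toℕ eq ⟩
  toℕ (inject₁ k)                  ≡⟨ toℕ-inject₁ k ⟩
  toℕ k                            ∎)
  where open ≡-Reasoning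

shareCell-next : (i : Fin (suc n)) → T (shareCell (suc n) i (next (suc n) i))
shareCell-next {n} i =
  from (T-∨ {⌊ i ≟ ni ⌋}) (inj₂ (from (T-∨ {⌊ i ≟ next (suc n) ni ⌋}) (inj₂
    (from (T-∨ {⌊ ni ≟ ni ⌋}) (inj₁ (fromWitness refl))))))
  where ni = next (suc n) i

shareCell-adjacent : {i j : Fin (suc n)} → i ≢ j → T (shareCell (suc n) i j) →
  next (suc n) i ≡ j ⊎ next (suc n) j ≡ i
shareCell-adjacent {n} {i} {j} i≢j share
  with to (T-∨ {⌊ i ≟ j ⌋}) share
... | inj₁ i≡j = ⊥-elim (i≢j (toWitness i≡j))
... | inj₂ share with to (T-∨ {⌊ i ≟ next (suc n) j ⌋}) share
...   | inj₁ i≡nj = inj₂ (sym (toWitness i≡nj))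
...   | inj₂ share with to (T-∨ {⌊ next (suc n) i ≟ j ⌋}) share
...     | inj₁ ni≡j  = inj₁ (toWitness ni≡j)
...     | inj₂ ni≡nj = ⊥-elim (i≢j (next-injective (toWitness ni≡nj)))

lookup-∷ʳ-next : ∀ {A : Set} (x : A) (V : Vec A n) (i : Fin (suc n)) →
  lookup (V ∷ʳ x) i ≡ lookup (x ∷ V) (next (suc n) i)
lookup-∷ʳ-next {n} x V i with view i
... | ‵fromℕ     = trans (lookup-∷ʳ-fromℕ x V) (cong (lookup (x ∷ V)) (sym (next-fromℕ n)))
... | ‵inject₁ j = trans (lookup-∷ʳ-inject₁ x V j) (cong (lookup (x ∷ V)) (sym (next-inject₁ j)))

Independent : (p : ℕ) .{{_ : NonZero p}} → Subset p → Set
Independent p S = ∀ i → T (lookup S i) → T (lookup S (next p i)) → ⊥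

isPlacement⇔Independent : 1 ≤ n → (S : Subset (suc n)) →
  T (isPlacement (suc n) S) ⇔ Independent (suc n) S
isPlacement⇔Independent {n} 1≤n S = mk⇔ independent placement
  where
  independent : T (isPlacement (suc n) S) → Independent (suc n) S
  independent h i Si Sni = to T-not-∧ (to (T-all-allFin _) (to (T-all-allFin _) h i) (next (suc n) i)) Si
    (from T-∧ (Sni , from T-∧ (fromWitnessFalse (next-≢ 1≤n i ∘ sym) , shareCell-next i)))
  placement : Independent (suc n) S → T (isPlacement (suc n) S)
  placement ind = from (T-all-allFin _) λ i → from (T-all-allFin _) λ j → from T-not-∧ λ Si rest →
    let Sj , rest = to T-∧ rest
        i≢j , share = to T-∧ rest
    in [ (λ ni≡j → ind i Si (subst (T ∘ lookup S) (sym ni≡j) Sj))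
       , (λ nj≡i → ind j Sj (subst (T ∘ lookup S) (sym nj≡i) Si)) ]
       (shareCell-adjacent (toWitnessFalse i≢j) share)

Disjoint : Vec Bool n → Vec Bool n → Set
Disjoint u v = ∀ i → T (lookup u i) → T (lookup v i) → ⊥

adjacentFree : Bool → Bool → Vec Bool n → Bool
adjacentFree prev last []      = not (prev ∧ last)
adjacentFree prev last (b ∷ V) = not (prev ∧ b) ∧ adjacentFree b last V

adjacentFree⇔Disjoint : ∀ prev last (V : Vec Bool n) →
  T (adjacentFree prev last V) ⇔ Disjoint (prev ∷ V) (V ∷ʳ last)
adjacentFree⇔Disjoint prev last [] = mk⇔ (λ { h zero → to T-not-∧ h }) (λ h → from T-not-∧ (h zero))
adjacentFree⇔Disjoint prev last (b ∷ V) = mk⇔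
  (λ h → let here , rest = to T-∧ h
         in ∀-cons (to T-not-∧ here) (to (adjacentFree⇔Disjoint b last V) rest))
  (λ h → from T-∧ (from T-not-∧ (h zero) , from (adjacentFree⇔Disjoint b last V) (h ∘ suc)))

cyclicallyAdjacentFree : Vec Bool n → Bool
cyclicallyAdjacentFree []      = true
cyclicallyAdjacentFree (b ∷ V) = adjacentFree b b V

cyclicallyAdjacentFree⇔Independent : (S : Subset (suc n)) →
  T (cyclicallyAdjacentFree S) ⇔ Independent (suc n) S
cyclicallyAdjacentFree⇔Independent (b ∷ V) = mk⇔
  (λ h i Si Sni → to (adjacentFree⇔Disjoint b b V) h i Si (subst T (sym (lookup-∷ʳ-next b V i)) Sni))
  (λ ind → from (adjacentFree⇔Disjoint b b V) λ i Si Vi → ind i Si (subst T (lookup-∷ʳ-next b V i) Vi))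

isPlacement≡cyclicallyAdjacentFree : 1 ≤ n → (S : Subset (suc n)) →
  isPlacement (suc n) S ≡ cyclicallyAdjacentFree S
isPlacement≡cyclicallyAdjacentFree 1≤n S =
  T-⇔⇒≡ (⇔-trans (isPlacement⇔Independent 1≤n S) (⇔-sym (cyclicallyAdjacentFree⇔Independent S)))

placements≡filter-cyclicallyAdjacentFree : 1 ≤ n →
  placements (suc n) ≡ filterᵇ cyclicallyAdjacentFree (allSubsets (suc n))
placements≡filter-cyclicallyAdjacentFree {n} 1≤n =
  filter-≐ (T? ∘ isPlacement _) (T? ∘ cyclicallyAdjacentFree)
    ( (λ {S} → subst T (isPlacement≡cyclicallyAdjacentFree 1≤n S))
    , (λ {S} → subst T (sym (isPlacement≡cyclicallyAdjacentFree 1≤n S))))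
    (allSubsets (suc n))

sign : ℕ → ℤ
sign k = if even? k then + 1 else - + 1

sign-suc : ∀ k → sign (suc k) ≡ - sign k
sign-suc k with even? k
... | true  = refl
... | false = refl

signedSum : List (Subset n) → ℤ
signedSum []      = + 0
signedSum (S ∷ L) = sign ∣ S ∣ + signedSum L

signedSum-++ : (L M : List (Subset n)) → signedSum (L ++ M) ≡ signedSum L + signedSum M
signedSum-++ []      M = sym (ℤ.+-identityˡ _)
signedSum-++ (S ∷ L) M =
  trans (cong (_+_ (sign ∣ S ∣)) (signedSum-++ L M)) (sym (ℤ.+-assoc (sign ∣ S ∣) _ _))

signedSum-map-false∷ : (L : List (Subset n)) → signedSum (map (false ∷_) L) ≡ signedSum L
signedSum-map-false∷ []      = refl
signedSum-map-false∷ (S ∷ L) = cong (_+_ (sign ∣ S ∣)) (signedSum-map-false∷ L)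

signedSum-map-true∷ : (L : List (Subset n)) → signedSum (map (true ∷_) L) ≡ - signedSum L
signedSum-map-true∷ []      = refl
signedSum-map-true∷ (S ∷ L) =
  trans (cong₂ _+_ (sign-suc ∣ S ∣) (signedSum-map-true∷ L)) (sym (ℤ.neg-distrib-+ (sign ∣ S ∣) _))

filterᵇ-allSubsets : (P : Subset (suc n) → Bool) → filterᵇ P (allSubsets (suc n)) ≡
  map (false ∷_) (filterᵇ (P ∘ (false ∷_)) (allSubsets n)) ++
  map (true ∷_) (filterᵇ (P ∘ (true ∷_)) (allSubsets n))
filterᵇ-allSubsets {n} P = trans (filter-++ (T? ∘ P) (map (false ∷_) (allSubsets n)) _)
  (cong₂ _++_ (filterᵇ-map P (false ∷_) (allSubsets n)) (filterᵇ-map P (true ∷_) (allSubsets n)))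

signedSum-filter-allSubsets : ∀ n (P : Subset (suc n) → Bool) →
  signedSum (filterᵇ P (allSubsets (suc n))) ≡
  signedSum (filterᵇ (P ∘ (false ∷_)) (allSubsets n)) -
  signedSum (filterᵇ (P ∘ (true ∷_)) (allSubsets n))
signedSum-filter-allSubsets n P = begin
  signedSum (filterᵇ P (allSubsets (suc n)))
    ≡⟨ cong signedSum (filterᵇ-allSubsets P) ⟩
  signedSum (map (false ∷_) F ++ map (true ∷_) R)
    ≡⟨ signedSum-++ (map (false ∷_) F) _ ⟩
  signedSum (map (false ∷_) F) + signedSum (map (true ∷_) R)
    ≡⟨ cong₂ _+_ (signedSum-map-false∷ F) (signedSum-map-true∷ R) ⟩
  signedSum F - signedSum R ∎
  where
  open ≡-Reasoning
  F = filterᵇ (P ∘ (false ∷_)) (allSubsets n)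
  R = filterᵇ (P ∘ (true ∷_)) (allSubsets n)

adjacentFreeSign : Bool → Bool → ℕ → ℤ
adjacentFreeSign prev  last zero    = if not (prev ∧ last) then + 1 else + 0
adjacentFreeSign false last (suc n) = adjacentFreeSign false last n - adjacentFreeSign true last n
adjacentFreeSign true  last (suc n) = adjacentFreeSign false last n

signedSum-adjacentFree : ∀ n prev last →
  signedSum (filterᵇ (adjacentFree prev last) (allSubsets n)) ≡ adjacentFreeSign prev last n
signedSum-adjacentFree zero prev last with not (prev ∧ last)
... | true  = refl
... | false = refl
signedSum-adjacentFree (suc n) false last = trans (signedSum-filter-allSubsets n (adjacentFree false last))
  (cong₂ _-_ (signedSum-adjacentFree n false last) (signedSum-adjacentFree n true last))
signedSum-adjacentFree (suc n) true last = begin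
  signedSum (filterᵇ (adjacentFree true last) (allSubsets (suc n)))
    ≡⟨ signedSum-filter-allSubsets n (adjacentFree true last) ⟩
  signedSum (filterᵇ (adjacentFree false last) (allSubsets n)) -
  signedSum (filterᵇ (λ _ → false) (allSubsets n))
    ≡⟨ cong₂ _-_ (signedSum-adjacentFree n false last) (cong signedSum (filterᵇ-false (allSubsets n))) ⟩
  adjacentFreeSign false last n - + 0
    ≡⟨ ℤ.+-identityʳ _ ⟩
  adjacentFreeSign false last n ∎
  where open ≡-Reasoning

-- The alternating count for the circle of length suc m.
cyclicSign : ℕ → ℤ
cyclicSign m = adjacentFreeSign false false m - adjacentFreeSign true true m

signedSum-cyclicallyAdjacentFree : ∀ m →
  signedSum (filterᵇ cyclicallyAdjacentFree (allSubsets (suc m))) ≡ cyclicSign m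
signedSum-cyclicallyAdjacentFree m = trans (signedSum-filter-allSubsets m cyclicallyAdjacentFree)
  (cong₂ _-_ (signedSum-adjacentFree m false false) (signedSum-adjacentFree m true true))

adjacentFreeSign-6+ : ∀ prev last n → adjacentFreeSign prev last (6 ℕ.+ n) ≡ adjacentFreeSign prev last n
adjacentFreeSign-6+ false false zero = refl
adjacentFreeSign-6+ false true  zero = refl
adjacentFreeSign-6+ true  false zero = refl
adjacentFreeSign-6+ true  true  zero = refl
adjacentFreeSign-6+ false last (suc n) =
  cong₂ _-_ (adjacentFreeSign-6+ false last n) (adjacentFreeSign-6+ true last n)
adjacentFreeSign-6+ true  last (suc n) = adjacentFreeSign-6+ false last n

cyclicSign-6+ : ∀ n → cyclicSign (6 ℕ.+ n) ≡ cyclicSign n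
cyclicSign-6+ n = cong₂ _-_ (adjacentFreeSign-6+ false false n) (adjacentFreeSign-6+ true true n)

cyclicSign-periodic : ∀ r q → cyclicSign (r ℕ.+ q ℕ.* 6) ≡ cyclicSign r
cyclicSign-periodic r zero    = cong cyclicSign (ℕ.+-identityʳ r)
cyclicSign-periodic r (suc q) = begin
  cyclicSign (r ℕ.+ (6 ℕ.+ q ℕ.* 6)) ≡⟨ cong cyclicSign (ℕ.+-comm r (6 ℕ.+ q ℕ.* 6)) ⟩
  cyclicSign (6 ℕ.+ q ℕ.* 6 ℕ.+ r)   ≡⟨ cong cyclicSign (ℕ.+-assoc 6 (q ℕ.* 6) r) ⟩
  cyclicSign (6 ℕ.+ (q ℕ.* 6 ℕ.+ r)) ≡⟨ cyclicSign-6+ (q ℕ.* 6 ℕ.+ r) ⟩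
  cyclicSign (q ℕ.* 6 ℕ.+ r)         ≡⟨ cong cyclicSign (ℕ.+-comm (q ℕ.* 6) r) ⟩
  cyclicSign (r ℕ.+ q ℕ.* 6)         ≡⟨ cyclicSign-periodic r q ⟩
  cyclicSign r                       ∎
  where open ≡-Reasoning

isEmpty isOdd isEvenNonempty : Subset n → Bool
isEmpty        S = isZero ∣ S ∣
isOdd          S = not (even? ∣ S ∣)
isEvenNonempty S = even? ∣ S ∣ ∧ not (isZero ∣ S ∣)

count-isEmpty-filter : ∀ n (P : Subset n → Bool) → T (P (replicate n false)) →
  count isEmpty (filterᵇ P (allSubsets n)) ≡ 1
count-isEmpty-filter zero P h with P [] | h
... | true  | _  = refl
... | false | ()
count-isEmpty-filter (suc n) P h = begin
  count isEmpty (filterᵇ P (allSubsets (suc n)))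
    ≡⟨ cong (count isEmpty) (filterᵇ-allSubsets P) ⟩
  count isEmpty (map (false ∷_) F ++ map (true ∷_) R)
    ≡⟨ count-++ isEmpty (map (false ∷_) F) _ ⟩
  count isEmpty (map (false ∷_) F) ℕ.+ count isEmpty (map (true ∷_) R)
    ≡⟨ cong₂ ℕ._+_ (count-map isEmpty (false ∷_) F) (count-map isEmpty (true ∷_) R) ⟩
  count isEmpty F ℕ.+ count (λ _ → false) R
    ≡⟨ cong₂ ℕ._+_ (count-isEmpty-filter n (P ∘ (false ∷_)) h) (cong length (filterᵇ-false R)) ⟩
  1 ∎
  where
  open ≡-Reasoning
  F = filterᵇ (P ∘ (false ∷_)) (allSubsets n)
  R = filterᵇ (P ∘ (true ∷_)) (allSubsets n)

signedSum-parity : (L : List (Subset n)) →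
  signedSum L + + count isOdd L ≡ + count isEvenNonempty L + + count isEmpty L
signedSum-parity []      = refl
signedSum-parity (S ∷ L) with ∣ S ∣ | signedSum-parity L
... | zero  | ih = begin
  + 1 + signedSum L + + count isOdd L                ≡⟨ ℤ.+-assoc (+ 1) (signedSum L) _ ⟩
  + 1 + (signedSum L + + count isOdd L)              ≡⟨ cong (_+_ (+ 1)) ih ⟩
  + suc (count isEvenNonempty L ℕ.+ count isEmpty L) ≡⟨ cong +_ (sym (ℕ.+-suc _ _)) ⟩
  + count isEvenNonempty L + + suc (count isEmpty L) ∎
  where open ≡-Reasoning
... | suc k | ih with even? k
...   | true  = trans (cancel (signedSum L) _) ih
  where cancel : ∀ s x → (- + 1 + s) + (+ 1 + x) ≡ s + x
        cancel = solve-∀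
...   | false = trans (ℤ.+-assoc (+ 1) (signedSum L) _) (cong (_+_ (+ 1)) ih)

prime-mod-6 : ∀ {p} → Prime p → 5 ≤ p → ∃[ q ] (p ≡ 1 ℕ.+ q ℕ.* 6 ⊎ p ≡ 5 ℕ.+ q ℕ.* 6)
prime-mod-6 {p} pr 5≤p = q , residue (p % 6) (m%n<n p 6) (m≡m%n+[m/n]*n p 6)
  where
  q = p / 6

  small-divisor : ∀ d .{{_ : NonTrivial d}} r → d ≤ 3 → d ∣ r → d ∣ 6 → p ≡ r ℕ.+ q ℕ.* 6 → ⊥
  small-divisor d r d≤3 d∣r d∣6 e = Prime.notComposite pr
    (composite (ℕ.≤-trans (s≤s d≤3) (ℕ.≤-trans (ℕ.n≤1+n 4) 5≤p))
      (subst (d ∣_) (sym e) (∣m∣n⇒∣m+n d∣r (∣-trans d∣6 (n∣m*n q)))))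

  residue : ∀ r → r < 6 → p ≡ r ℕ.+ q ℕ.* 6 → p ≡ 1 ℕ.+ q ℕ.* 6 ⊎ p ≡ 5 ℕ.+ q ℕ.* 6
  residue 0 _ e = ⊥-elim (small-divisor 2 0 (s≤s (s≤s z≤n)) (divides 0 refl) (divides 3 refl) e)
  residue 1 _ e = inj₁ e
  residue 2 _ e = ⊥-elim (small-divisor 2 2 (s≤s (s≤s z≤n)) ∣-refl (divides 3 refl) e)
  residue 3 _ e = ⊥-elim (small-divisor 3 3 (s≤s (s≤s (s≤s z≤n))) ∣-refl (divides 2 refl) e)
  residue 4 _ e = ⊥-elim (small-divisor 2 4 (s≤s (s≤s z≤n)) (divides 2 refl) (divides 3 refl) e)
  residue 5 _ e = inj₂ e
  residue (suc (suc (suc (suc (suc (suc r)))))) (s≤s (s≤s (s≤s (s≤s (s≤s (s≤s ())))))) _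

cyclicSign-prime : ∀ {m} → Prime (suc m) → 5 ≤ suc m → cyclicSign m ≡ + 1
cyclicSign-prime pr 5≤p with prime-mod-6 pr 5≤p
... | q , inj₁ e = trans (cong cyclicSign (ℕ.suc-injective e)) (cyclicSign-periodic 0 q)
... | q , inj₂ e = trans (cong cyclicSign (ℕ.suc-injective e)) (cyclicSign-periodic 4 q)

signedSum-placements : 1 ≤ n → signedSum (placements (suc n)) ≡ cyclicSign n
signedSum-placements {n} 1≤n =
  trans (cong signedSum (placements≡filter-cyclicallyAdjacentFree 1≤n)) (signedSum-cyclicallyAdjacentFree n)

count-isEmpty-placements : 1 ≤ n → count isEmpty (placements (suc n)) ≡ 1
count-isEmpty-placements {n} 1≤n = count-isEmpty-filter (suc n) (isPlacement (suc n))
  (from (isPlacement⇔Independent 1≤n (replicate (suc n) false))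
    (λ i empty _ → subst T (lookup-replicate i false) empty))

corollary1 : (p : ℕ) → Prime p → 5 ≤ p → .{{_ : NonZero p}} →
    #evenNonzero p ≡ #odd p
corollary1 (suc n) pr 5≤p =
  sym (ℕ.suc-injective (trans (ℤ.+-injective balance) (ℕ.+-comm (#evenNonzero (suc n)) 1)))
  where
  open ≡-Reasoning
  1≤n : 1 ≤ n
  1≤n = ℕ.≤-trans (s≤s z≤n) (ℕ.≤-pred 5≤p)
  balance : + 1 + + #odd (suc n) ≡ + #evenNonzero (suc n) + + 1
  balance = begin
    + 1 + + #odd (suc n)
      ≡⟨ cong (_+ + #odd (suc n)) (sym (cyclicSign-prime pr 5≤p)) ⟩
    cyclicSign n + + #odd (suc n)
      ≡⟨ cong (_+ + #odd (suc n)) (sym (signedSum-placements 1≤n)) ⟩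
    signedSum (placements (suc n)) + + #odd (suc n)
      ≡⟨ signedSum-parity (placements (suc n)) ⟩
    + #evenNonzero (suc n) + + count isEmpty (placements (suc n))
      ≡⟨ cong (λ k → + #evenNonzero (suc n) + + k) (count-isEmpty-placements 1≤n) ⟩
    + #evenNonzero (suc n) + + 1 ∎
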